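{- Let $F$ be a face of the Coxeter fan of $W_0$, let $f$ lie in its relative interior, and let $\Phi'$ be a union of indecomposable components of $\Phi_F$. Then $B(F,\Phi')=\{\beta\in\Phi^+:\langle f,\beta\rangle<0\}\cup(\Phi'\cap\Phi^+)$ is a biclosed subset of $\Phi^+$.
   Context: Affine root system: $\Phi_0$ a finite, indecomposable, crystallographic root system in $V_0$ with positive roots $\Phi_0^+$ and Weyl group $W_0$; $V=V_0\oplus\mathbb{R}\delta$; $\Phi=\{\alpha+k\delta:\alpha\in\Phi_0,k\in\mathbb{Z}\}$, $\Phi^+=\Phi_0^+\cup\{\alpha+k\delta:\alpha\in\Phi_0,k\ge1\}$. $B\subseteq\Phi^+$ is biclosed if for all $\alpha,\beta,\gamma\in\Phi^+$ with $\gamma\in\mathbb{R}_{>0}\alpha+\mathbb{R}_{>0}\beta$: $\alpha,\beta\in B\Rightarrow\gamma\in B$, and $\alpha,\beta\notin B\Rightarrow\gamma\notin B$. The Coxeter fan of $W_0$ in $V_0^\vee$ has faces all intersections of $W_0$-translates of the dominant chamber $\{f:\langle f,\alpha\rangle\ge0\ \forall\alpha\in\Phi_0^+\}$ (including $\{0\}$); functionals on $V_0$ are extended to $V$ by $\langle f,\delta\rangle=0$. $\Phi_F=\{\beta\in\Phi:\langle f,\beta\rangle=0\}$, which decomposes uniquely as a disjoint union of mutually orthogonal indecomposable root subsystems (its components).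
   Formalization: The root system $\Phi_0$ has rational coordinates, and the functional f and the positive coefficients in the definition of biclosed are rational rather than real. -}

module Defs where

open import Data.Nat using (ℕ; zero; suc)
open import Data.Integer as ℤ using (ℤ)
open import Data.Rational using (ℚ; 0ℚ; 1ℚ; _+_; _*_; _-_; -_; _<_; _≤_; 1/_; ≢-nonZero)
open import Data.Rational.Properties using (_≟_)
import Data.Rational as Q
open import Data.Vec using (Vec; []; _∷_; zipWith; map)
open import Data.List using (List; []; _∷_)
open import Data.List.Membership.Propositional using (_∈_)
open import Data.List.Relation.Unary.All using (All)
open import Data.Product using (Σ; _×_; _,_; ∃; proj₁; proj₂)
open import Data.Sum using (_⊎_)
open import Relation.Binary.PropositionalEquality using (_≡_; _≢_)
open import Relation.Nullary using (¬_; yes; no)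

-- Linear algebra on V₀ = ℚ^m (ambient Euclidean space with the standard
-- dot product; functionals are identified with vectors via this form).

Vect : ℕ → Set
Vect m = Vec ℚ m

_⊕_ : ∀ {m} → Vect m → Vect m → Vect m
u ⊕ v = zipWith _+_ u v

_⊖_ : ∀ {m} → Vect m → Vect m → Vect m
u ⊖ v = zipWith _-_ u v

_·_ : ∀ {m} → ℚ → Vect m → Vect m
c · v = map (c *_) v

dot : ∀ {m} → Vect m → Vect m → ℚ
dot [] [] = 0ℚ
dot (x ∷ u) (y ∷ v) = x * y + dot u v

two : ℚ
two = 1ℚ + 1ℚ

ℤtoℚ : ℤ → ℚ
ℤtoℚ z = z Q./ 1

-- reflection s_α(v) = v - (2 (α·v)/(α·α)) α   (identity if α = 0,
-- which never happens for roots)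
reflect : ∀ {m} → Vect m → Vect m → Vect m
reflect α v with dot α α ≟ 0ℚ
... | yes _ = v
... | no  p = v ⊖ (((two * dot α v) * (1/_ (dot α α) {{≢-nonZero p}})) · α)

-- Finite (reduced) crystallographic root systems, given as a finite list
-- of vectors in ℚ^m; V₀ is their span.

record IsRootSystem {m : ℕ} (Φ₀ : List (Vect m)) : Set where
  field
    nonzero   : ∀ {α} → α ∈ Φ₀ → dot α α ≢ 0ℚ
    reflClosed : ∀ {α β} → α ∈ Φ₀ → β ∈ Φ₀ → reflect α β ∈ Φ₀
    crystallographic : ∀ {α β} → α ∈ Φ₀ → β ∈ Φ₀ →
      ∃ λ (z : ℤ) → two * dot α β ≡ ℤtoℚ z * dot α α
    reduced   : ∀ {α} (c : ℚ) → α ∈ Φ₀ → (c · α) ∈ Φ₀ → c ≡ 1ℚ ⊎ c ≡ - 1ℚ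

-- indecomposable: nonempty, and not a disjoint union of two nonempty
-- mutually orthogonal subsets (equivalently: every property of roots
-- preserved along non-orthogonal pairs holds for all roots once it holds
-- for one).
record Indecomposable {m : ℕ} (Φ₀ : List (Vect m)) : Set₁ where
  field
    nonempty : ∃ λ α → α ∈ Φ₀
    connected : (P : Vect m → Set) →
      (∀ {α β} → α ∈ Φ₀ → β ∈ Φ₀ → dot α β ≢ 0ℚ → P α → P β) →
      ∀ {α β} → α ∈ Φ₀ → β ∈ Φ₀ → P α → P β

-- positive system determined by a regular vector h: Φ₀⁺ = {α : ⟨h,α⟩ > 0}
Regular : ∀ {m} → List (Vect m) → Vect m → Set
Regular Φ₀ h = ∀ {α} → α ∈ Φ₀ → dot h α ≢ 0ℚ

Pos₀ : ∀ {m} → List (Vect m) → Vect m → Vect m → Set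
Pos₀ Φ₀ h α = α ∈ Φ₀ × 0ℚ < dot h α

-- Weyl group W₀: elements given by words in reflections s_α (α ∈ Φ₀).

Word : ℕ → Set
Word m = List (Vect m)

ValidWord : ∀ {m} → List (Vect m) → Word m → Set
ValidWord Φ₀ w = All (_∈ Φ₀) w

act : ∀ {m} → Word m → Vect m → Vect m
act [] v = v
act (α ∷ w) v = reflect α (act w v)

Dominant : ∀ {m} → List (Vect m) → Vect m → Vect m → Set
Dominant Φ₀ h f = ∀ {α} → Pos₀ Φ₀ h α → 0ℚ ≤ dot f α

Translate : ∀ {m} → List (Vect m) → Vect m → Word m → Vect m → Set
Translate Φ₀ h w f = ∃ λ g → Dominant Φ₀ h g × f ≡ act w g

-- face of the Coxeter fan cut out by a nonempty finite family S of
-- Weyl group elements: F = ⋂_{w ∈ S} w(C)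
Face : ∀ {m} → List (Vect m) → Vect m → List (Word m) → Vect m → Set
Face Φ₀ h S f = All (λ w → Translate Φ₀ h w f) S

-- relative interior of a convex set F (algebraic relative interior):
-- f ∈ F and for every g ∈ F the segment from g through f extends
-- slightly beyond f inside F.
RelInt : ∀ {m} → (Vect m → Set) → Vect m → Set
RelInt F f = F f × (∀ g → F g → ∃ λ ε → 0ℚ < ε × F (f ⊕ (ε · (f ⊖ g))))

-- Affine roots: α + kδ is encoded as (α , k); V = V₀ ⊕ ℚδ.

AffVec : ℕ → Set
AffVec m = Vect m × ℚ

AffRoot : ℕ → Set
AffRoot m = Vect m × ℤ

toAff : ∀ {m} → AffRoot m → AffVec m
toAff (α , k) = α , ℤtoℚ k

IsAffRoot : ∀ {m} → List (Vect m) → AffRoot m → Set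
IsAffRoot Φ₀ (α , k) = α ∈ Φ₀

IsPosAffRoot : ∀ {m} → List (Vect m) → Vect m → AffRoot m → Set
IsPosAffRoot Φ₀ h (α , k) = (Pos₀ Φ₀ h α × k ≡ ℤ.+ 0) ⊎ (α ∈ Φ₀ × ℤ.+ 1 ℤ.≤ k)

-- pairing of a functional f on V₀ (extended by ⟨f,δ⟩ = 0) with an affine root
pair : ∀ {m} → Vect m → AffRoot m → ℚ
pair f (α , k) = dot f α

-- bilinear form on V (δ in the radical)
form : ∀ {m} → AffRoot m → AffRoot m → ℚ
form (α , _) (β , _) = dot α β

Biclosed : ∀ {m} → List (Vect m) → Vect m → (AffRoot m → Set) → Set
Biclosed Φ₀ h B =
  ∀ α β γ → IsPosAffRoot Φ₀ h α → IsPosAffRoot Φ₀ h β → IsPosAffRoot Φ₀ h γ →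
  (∃ λ a → ∃ λ b → 0ℚ < a × 0ℚ < b ×
     toAff γ ≡ ((a · proj₁ α) ⊕ (b · proj₁ β) ,
                a * ℤtoℚ (proj₂ α) + b * ℤtoℚ (proj₂ β))) →
  ((B α → B β → B γ) × (¬ B α → ¬ B β → ¬ B γ))

InΦF : ∀ {m} → List (Vect m) → Vect m → AffRoot m → Set
InΦF Φ₀ f β = IsAffRoot Φ₀ β × pair f β ≡ 0ℚ

-- Φ' is a union of indecomposable components of Φ_F: a subset of Φ_F
-- which, with any root, contains every root of Φ_F non-orthogonal to it
-- (components = connected components of the non-orthogonality graph).
UnionOfComponents : ∀ {m} → List (Vect m) → Vect m → (AffRoot m → Set) → Set
UnionOfComponents Φ₀ f Φ' =
  (∀ β → Φ' β → InΦF Φ₀ f β) ×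
  (∀ β γ → InΦF Φ₀ f β → InΦF Φ₀ f γ → form β γ ≢ 0ℚ → Φ' β → Φ' γ)

BFΦ : ∀ {m} → List (Vect m) → Vect m → Vect m → (AffRoot m → Set) → AffRoot m → Set
BFΦ Φ₀ h f Φ' β = (IsPosAffRoot Φ₀ h β × pair f β < 0ℚ) ⊎ (Φ' β × IsPosAffRoot Φ₀ h β)

-- Write γ = aα + bβ with a, b > 0, so that ⟨f,γ⟩ = a⟨f,α⟩ + b⟨f,β⟩. The sign of ⟨f,-⟩ settles
-- every case except the one where all three pairings vanish, i.e. α, β, γ ∈ Φ_F. There,
-- (γ,γ) = a(γ,α) + b(γ,β) ≠ 0 makes γ non-orthogonal to α or to β, so γ lies in the same
-- component of Φ_F as one of them; hence Φ' contains γ when it contains α and β, and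
-- contains α or β when it contains γ.
module Submission where

open import Defs
open import Data.Nat using (ℕ)
open import Data.List using (List; [])
open import Data.List.Relation.Unary.All using (All)
open import Data.Rational
  using (ℚ; 0ℚ; _+_; _*_; _<_; _≤_; Positive; positive; negative; nonPositive; nonNegative)
open import Data.Rational.Properties
open import Data.Vec using ([]; _∷_)
open import Data.Product using (_×_; _,_; proj₁; proj₂)
open import Data.Sum using (_⊎_; inj₁; inj₂; [_,_])
open import Relation.Nullary using (¬_; yes; no; contradiction)
open import Relation.Binary.PropositionalEquality
  using (_≡_; _≢_; refl; sym; trans; cong; cong₂; subst; module ≡-Reasoning)

open ≡-Reasoning

dot-comm : ∀ {m} (u v : Vect m) → dot u v ≡ dot v u
dot-comm [] [] = refl
dot-comm (x ∷ u) (y ∷ v) = cong₂ _+_ (*-comm x y) (dot-comm u v)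

+-interchange : ∀ p q r s → (p + q) + (r + s) ≡ (p + r) + (q + s)
+-interchange p q r s = begin
  (p + q) + (r + s)  ≡⟨ +-assoc p q (r + s) ⟩
  p + (q + (r + s))  ≡⟨ cong (p +_) (sym (+-assoc q r s)) ⟩
  p + ((q + r) + s)  ≡⟨ cong (λ t → p + (t + s)) (+-comm q r) ⟩
  p + ((r + q) + s)  ≡⟨ cong (p +_) (+-assoc r q s) ⟩
  p + (r + (q + s))  ≡⟨ sym (+-assoc p r (q + s)) ⟩
  (p + r) + (q + s)  ∎

dot-⊕ʳ : ∀ {m} (v u w : Vect m) → dot v (u ⊕ w) ≡ dot v u + dot v w
dot-⊕ʳ [] [] [] = sym (+-identityʳ 0ℚ)
dot-⊕ʳ (x ∷ v) (y ∷ u) (z ∷ w) = begin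
  x * (y + z) + dot v (u ⊕ w)            ≡⟨ cong₂ _+_ (*-distribˡ-+ x y z) (dot-⊕ʳ v u w) ⟩
  (x * y + x * z) + (dot v u + dot v w)  ≡⟨ +-interchange (x * y) (x * z) (dot v u) (dot v w) ⟩
  (x * y + dot v u) + (x * z + dot v w)  ∎

dot-·ʳ : ∀ {m} (v : Vect m) c (u : Vect m) → dot v (c · u) ≡ c * dot v u
dot-·ʳ [] c [] = sym (*-zeroʳ c)
dot-·ʳ (x ∷ v) c (y ∷ u) = begin
  x * (c * y) + dot v (c · u)  ≡⟨ cong₂ _+_ (*-assoc-comm x c y) (dot-·ʳ v c u) ⟩
  c * (x * y) + c * dot v u    ≡⟨ sym (*-distribˡ-+ c (x * y) (dot v u)) ⟩
  c * (x * y + dot v u)        ∎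
  where
  *-assoc-comm : ∀ p q r → p * (q * r) ≡ q * (p * r)
  *-assoc-comm p q r = trans (sym (*-assoc p q r)) (trans (cong (_* r) (*-comm p q)) (*-assoc q p r))

dot-combinationʳ : ∀ {m} (v α β : Vect m) a b →
  dot v ((a · α) ⊕ (b · β)) ≡ a * dot v α + b * dot v β
dot-combinationʳ v α β a b =
  trans (dot-⊕ʳ v (a · α) (b · β)) (cong₂ _+_ (dot-·ʳ v a α) (dot-·ʳ v b β))

combination-≡0 : ∀ a b {x y} → x ≡ 0ℚ → y ≡ 0ℚ → a * x + b * y ≡ 0ℚ
combination-≡0 a b refl refl = trans (cong₂ _+_ (*-zeroʳ a) (*-zeroʳ b)) (+-identityʳ 0ℚ)

combination-≢0 : ∀ a b {x y} → a * x + b * y ≢ 0ℚ → x ≢ 0ℚ ⊎ y ≢ 0ℚ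
combination-≢0 a b {x} {y} ≢0 with x ≟ 0ℚ | y ≟ 0ℚ
... | no x≢0 | _      = inj₁ x≢0
... | yes _  | no y≢0 = inj₂ y≢0
... | yes x≡0 | yes y≡0 = contradiction (combination-≡0 a b x≡0 y≡0) ≢0

module _ (a b : ℚ) .{{_ : Positive a}} .{{_ : Positive b}} where

  posCombination-<0ˡ : ∀ {x y} → x < 0ℚ → y ≤ 0ℚ → a * x + b * y < 0ℚ
  posCombination-<0ˡ {x} {y} x<0 y≤0 = negative⁻¹ (a * x + b * y)
    {{neg+nonPos⇒neg (a * x) {{pos*neg⇒neg a x {{negative x<0}}}}
                     (b * y) {{nonNeg*nonPos⇒nonPos b {{pos⇒nonNeg b}} y {{nonPositive y≤0}}}}}}

  posCombination-<0ʳ : ∀ {x y} → x ≤ 0ℚ → y < 0ℚ → a * x + b * y < 0ℚ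
  posCombination-<0ʳ {x} {y} x≤0 y<0 = negative⁻¹ (a * x + b * y)
    {{nonPos+neg⇒neg (a * x) {{nonNeg*nonPos⇒nonPos a {{pos⇒nonNeg a}} x {{nonPositive x≤0}}}}
                     (b * y) {{pos*neg⇒neg b y {{negative y<0}}}}}}

  posCombination->0ˡ : ∀ {x y} → 0ℚ < x → 0ℚ ≤ y → 0ℚ < a * x + b * y
  posCombination->0ˡ {x} {y} 0<x 0≤y = positive⁻¹ (a * x + b * y)
    {{pos+nonNeg⇒pos (a * x) {{pos*pos⇒pos a x {{positive 0<x}}}}
                     (b * y) {{nonNeg*nonNeg⇒nonNeg b {{pos⇒nonNeg b}} y {{nonNegative 0≤y}}}}}}

  posCombination->0ʳ : ∀ {x y} → 0ℚ ≤ x → 0ℚ < y → 0ℚ < a * x + b * y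
  posCombination->0ʳ {x} {y} 0≤x 0<y = positive⁻¹ (a * x + b * y)
    {{nonNeg+pos⇒pos (a * x) {{nonNeg*nonNeg⇒nonNeg a {{pos⇒nonNeg a}} x {{nonNegative 0≤x}}}}
                     (b * y) {{pos*pos⇒pos b y {{positive 0<y}}}}}}

  posCombination-≥0 : ∀ {x y} → 0ℚ ≤ x → 0ℚ ≤ y → 0ℚ ≤ a * x + b * y
  posCombination-≥0 {x} {y} 0≤x 0≤y = nonNegative⁻¹ (a * x + b * y)
    {{nonNeg+nonNeg⇒nonNeg (a * x) {{nonNeg*nonNeg⇒nonNeg a {{pos⇒nonNeg a}} x {{nonNegative 0≤x}}}}
                           (b * y) {{nonNeg*nonNeg⇒nonNeg b {{pos⇒nonNeg b}} y {{nonNegative 0≤y}}}}}}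

  posCombination-≡0⇒ : ∀ {x y} → 0ℚ ≤ x → 0ℚ ≤ y → a * x + b * y ≡ 0ℚ → x ≡ 0ℚ × y ≡ 0ℚ
  posCombination-≡0⇒ 0≤x 0≤y ≡0 =
    ≤-antisym (≮⇒≥ λ 0<x → <-irrefl (sym ≡0) (posCombination->0ˡ 0<x 0≤y)) 0≤x ,
    ≤-antisym (≮⇒≥ λ 0<y → <-irrefl (sym ≡0) (posCombination->0ʳ 0≤x 0<y)) 0≤y

posAffRoot⇒affRoot : ∀ {m} {Φ₀ : List (Vect m)} h γ → IsPosAffRoot Φ₀ h γ → IsAffRoot Φ₀ γ
posAffRoot⇒affRoot _ _ (inj₁ ((γ∈Φ₀ , _) , _)) = γ∈Φ₀
posAffRoot⇒affRoot _ _ (inj₂ (γ∈Φ₀ , _))       = γ∈Φ₀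

combination-nonOrthogonal : ∀ {m} {γ α β : Vect m} a b → dot γ γ ≢ 0ℚ →
  γ ≡ (a · α) ⊕ (b · β) → dot α γ ≢ 0ℚ ⊎ dot β γ ≢ 0ℚ
combination-nonOrthogonal {γ = γ} {α} {β} a b γ≢0 refl
  with combination-≢0 a b (λ ≡0 → γ≢0 (trans (dot-combinationʳ γ α β a b) ≡0))
... | inj₁ ≢0 = inj₁ (λ ≡0 → ≢0 (trans (dot-comm γ α) ≡0))
... | inj₂ ≢0 = inj₂ (λ ≡0 → ≢0 (trans (dot-comm γ β) ≡0))

module _ {m} {Φ₀ : List (Vect m)} {Φ' : AffRoot m → Set}
         (RS : IsRootSystem Φ₀) (f : Vect m) (Φ'-union : UnionOfComponents Φ₀ f Φ') where

  private
    Φ'⊆Φ_F = proj₁ Φ'-union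
    Φ'-saturated = proj₂ Φ'-union

  union-closed-under-combination : ∀ {α β γ} a b → InΦF Φ₀ f γ →
    proj₁ γ ≡ (a · proj₁ α) ⊕ (b · proj₁ β) → Φ' α → Φ' β → Φ' γ
  union-closed-under-combination {α} {β} {γ} a b γ∈Φ_F γ≡ Φ'α Φ'β
    with combination-nonOrthogonal a b (IsRootSystem.nonzero RS (proj₁ γ∈Φ_F)) γ≡
  ... | inj₁ ⟨α,γ⟩≢0 = Φ'-saturated α γ (Φ'⊆Φ_F α Φ'α) γ∈Φ_F ⟨α,γ⟩≢0 Φ'α
  ... | inj₂ ⟨β,γ⟩≢0 = Φ'-saturated β γ (Φ'⊆Φ_F β Φ'β) γ∈Φ_F ⟨β,γ⟩≢0 Φ'β

  union-splits-combination : ∀ {α β γ} a b → InΦF Φ₀ f α → InΦF Φ₀ f β →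
    proj₁ γ ≡ (a · proj₁ α) ⊕ (b · proj₁ β) → Φ' γ → Φ' α ⊎ Φ' β
  union-splits-combination {α} {β} {γ} a b α∈Φ_F β∈Φ_F γ≡ Φ'γ
    with combination-nonOrthogonal a b (IsRootSystem.nonzero RS (proj₁ (Φ'⊆Φ_F γ Φ'γ))) γ≡
  ... | inj₁ ⟨α,γ⟩≢0 = inj₁ (Φ'-saturated γ α (Φ'⊆Φ_F γ Φ'γ) α∈Φ_F
                               (λ ≡0 → ⟨α,γ⟩≢0 (trans (dot-comm (proj₁ α) (proj₁ γ)) ≡0)) Φ'γ)
  ... | inj₂ ⟨β,γ⟩≢0 = inj₂ (Φ'-saturated γ β (Φ'⊆Φ_F γ Φ'γ) β∈Φ_F
                               (λ ≡0 → ⟨β,γ⟩≢0 (trans (dot-comm (proj₁ β) (proj₁ γ)) ≡0)) Φ'γ)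

  module _ (h : Vect m) {α β γ : AffRoot m}
           (pα : IsPosAffRoot Φ₀ h α) (pβ : IsPosAffRoot Φ₀ h β) (pγ : IsPosAffRoot Φ₀ h γ)
           (a b : ℚ) .{{_ : Positive a}} .{{_ : Positive b}}
           (γ≡ : proj₁ γ ≡ (a · proj₁ α) ⊕ (b · proj₁ β)) where

    private
      B = BFΦ Φ₀ h f Φ'

      pair-γ : pair f γ ≡ a * pair f α + b * pair f β
      pair-γ = trans (cong (dot f) γ≡) (dot-combinationʳ f (proj₁ α) (proj₁ β) a b)

      pair<0⇒B : ∀ {x y} → a * x + b * y < 0ℚ → pair f γ ≡ a * x + b * y → B γ
      pair<0⇒B <0 ≡comb = inj₁ (pγ , subst (_< 0ℚ) (sym ≡comb) <0)

      ∉B⇒pair≥0 : ∀ {δ} → IsPosAffRoot Φ₀ h δ → ¬ B δ → 0ℚ ≤ pair f δ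
      ∉B⇒pair≥0 pδ δ∉B = ≮⇒≥ λ fδ<0 → δ∉B (inj₁ (pδ , fδ<0))

    BFΦ-closed-under-combination : B α → B β → B γ
    BFΦ-closed-under-combination (inj₁ (_ , fα<0)) (inj₁ (_ , fβ<0)) =
      pair<0⇒B (posCombination-<0ˡ a b fα<0 (<⇒≤ fβ<0)) pair-γ
    BFΦ-closed-under-combination (inj₁ (_ , fα<0)) (inj₂ (Φ'β , _)) =
      pair<0⇒B (posCombination-<0ˡ a b fα<0 (≤-reflexive (proj₂ (Φ'⊆Φ_F β Φ'β)))) pair-γ
    BFΦ-closed-under-combination (inj₂ (Φ'α , _)) (inj₁ (_ , fβ<0)) =
      pair<0⇒B (posCombination-<0ʳ a b (≤-reflexive (proj₂ (Φ'⊆Φ_F α Φ'α))) fβ<0) pair-γ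
    BFΦ-closed-under-combination (inj₂ (Φ'α , _)) (inj₂ (Φ'β , _)) =
      inj₂ (union-closed-under-combination a b γ∈Φ_F γ≡ Φ'α Φ'β , pγ)
      where
      γ∈Φ_F : InΦF Φ₀ f γ
      γ∈Φ_F = posAffRoot⇒affRoot h γ pγ ,
              trans pair-γ (combination-≡0 a b (proj₂ (Φ'⊆Φ_F α Φ'α)) (proj₂ (Φ'⊆Φ_F β Φ'β)))

    BFΦ-coclosed-under-combination : ¬ B α → ¬ B β → ¬ B γ
    BFΦ-coclosed-under-combination α∉B β∉B (inj₁ (_ , fγ<0)) =
      <-irrefl refl (<-≤-trans fγ<0 (subst (0ℚ ≤_) (sym pair-γ)
        (posCombination-≥0 a b (∉B⇒pair≥0 pα α∉B) (∉B⇒pair≥0 pβ β∉B))))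
    BFΦ-coclosed-under-combination α∉B β∉B (inj₂ (Φ'γ , _)) =
      [ (λ Φ'α → α∉B (inj₂ (Φ'α , pα))) , (λ Φ'β → β∉B (inj₂ (Φ'β , pβ))) ]
        (union-splits-combination a b (posAffRoot⇒affRoot h α pα , fα≡0)
                                      (posAffRoot⇒affRoot h β pβ , fβ≡0) γ≡ Φ'γ)
      where
      fα,fβ≡0 : pair f α ≡ 0ℚ × pair f β ≡ 0ℚ
      fα,fβ≡0 = posCombination-≡0⇒ a b (∉B⇒pair≥0 pα α∉B) (∉B⇒pair≥0 pβ β∉B)
                                   (trans (sym pair-γ) (proj₂ (Φ'⊆Φ_F γ Φ'γ)))
      fα≡0 = proj₁ fα,fβ≡0
      fβ≡0 = proj₂ fα,fβ≡0

lemma4p7 : (m : ℕ) (Φ₀ : List (Vect m)) (h : Vect m) →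
    IsRootSystem Φ₀ → Indecomposable Φ₀ → Regular Φ₀ h →
    (S : List (Word m)) → S ≢ [] → All (ValidWord Φ₀) S →
    (f : Vect m) → RelInt (Face Φ₀ h S) f →
    (Φ' : AffRoot m → Set) → UnionOfComponents Φ₀ f Φ' →
    Biclosed Φ₀ h (BFΦ Φ₀ h f Φ')
lemma4p7 _ _ h RS _ _ _ _ _ f _ _ Φ'-union α β γ pα pβ pγ (a , b , 0<a , 0<b , γ≡) =
  BFΦ-closed-under-combination RS f Φ'-union h pα pβ pγ a b γ₀≡ ,
  BFΦ-coclosed-under-combination RS f Φ'-union h pα pβ pγ a b γ₀≡
  where
  instance
    a-positive : Positive a
    a-positive = positive 0<a
    b-positive : Positive b
    b-positive = positive 0<b
  γ₀≡ : proj₁ γ ≡ (a · proj₁ α) ⊕ (b · proj₁ β)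
  γ₀≡ = cong proj₁ γ≡
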